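{- Let $\mathrm{rs}$ be the Rudin–Shapiro sequence defined by $\mathrm{rs}(0)=\mathrm{rs}(1)=0$, $\mathrm{rs}(2n)=\mathrm{rs}(n)$, $\mathrm{rs}(4n+1)=\mathrm{rs}(n)$ and $\mathrm{rs}(4n+3)=1-\mathrm{rs}(2n+1)$ for all $n \geq 0$. Then the running sum $\mathrm{sum}_{\mathrm{rs}}(n)=\sum_{i=0}^{n}\mathrm{rs}(i)$ is not $2$-synchronised.
   Context: A function $f:\mathbb{N}\to\mathbb{N}$ is $2$-synchronised if there is a finite automaton which, reading the base-$2$ representations of $n$ and $m$ in parallel (most significant digit first, the shorter padded with leading zeros), accepts exactly the pairs $(n,m)$ with $m = f(n)$. -}

module Defs where

open import Data.Nat using (ℕ; zero; suc; _+_; _*_; _∸_; _⊔_)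
open import Data.Nat.DivMod using (_/_; _%_)
open import Data.Bool using (Bool; true; false; T)
open import Data.Fin using (Fin)
open import Data.List using (List; []; _∷_; length; reverse; replicate; _++_; foldl; zip)
open import Data.Product using (_×_; _,_; Σ)
open import Relation.Binary.PropositionalEquality using (_≡_)
open import Function.Bundles using (_⇔_)

-- Implemented with a fuel argument; fuel n suffices for argument n since
-- every recursive call is on a strictly smaller argument.

rsF : ℕ → ℕ → ℕ
rsF zero    _ = 0
rsF (suc f) 0 = 0
rsF (suc f) 1 = 0
rsF (suc f) n@(suc (suc _)) with n % 4
... | 0 = rsF f (n / 2)
... | 2 = rsF f (n / 2)
... | 1 = rsF f (n / 4)
... | _ = 1 ∸ rsF f (2 * (n / 4) + 1)

rs : ℕ → ℕ
rs n = rsF n n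

sumRS : ℕ → ℕ
sumRS zero    = rs 0
sumRS (suc n) = sumRS n + rs (suc n)

-- canonical base-2 digits of n, least significant first, no leading
-- zeros (so 0 has the empty representation); fuel n suffices.
bitsF : ℕ → ℕ → List Bool
bitsF zero    _ = []
bitsF (suc f) zero = []
bitsF (suc f) n@(suc _) with n % 2
... | 0 = false ∷ bitsF f (n / 2)
... | _ = true  ∷ bitsF f (n / 2)

bitsLSB : ℕ → List Bool
bitsLSB n = bitsF n n

padLSB : ℕ → ℕ → List Bool
padLSB L n = bitsLSB n ++ replicate (L ∸ length (bitsLSB n)) false

-- the word read by the automaton on input (n , m): base-2 representations
-- of n and m in parallel, most significant digit first, the shorter one
-- padded with leading zeros.
pairWord : ℕ → ℕ → List (Bool × Bool)
pairWord n m =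
  let L = length (bitsLSB n) ⊔ length (bitsLSB m) in
  reverse (zip (padLSB L n) (padLSB L m))

-- Finite automata over the alphabet {0,1}²  (deterministic; equivalent
-- in power to nondeterministic ones).

record DFA : Set where
  field
    nStates : ℕ
    start   : Fin nStates
    step    : Fin nStates → Bool × Bool → Fin nStates
    final   : Fin nStates → Bool

accepts : DFA → List (Bool × Bool) → Bool
accepts A w = final (foldl step start w)
  where open DFA A

Synchronised₂ : (ℕ → ℕ) → Set
Synchronised₂ f =
  Σ DFA λ A → (n m : ℕ) → (T (accepts A (pairWord n m)) ⇔ (m ≡ f n))

-- For K ≥ 1, sum_rs(4^K − 1) = (4^K − 2^K)/2, whose binary expansion is K ones followed by K − 1
-- zeros; so an automaton for the graph of sum_rs accepts (1,0)(1,1)^K(1,0)^(K−1), the encoding of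
-- the pair (4^K − 1, sum_rs(4^K − 1)).  The run through the block of (1,1) letters eventually
-- cycles, and going around the cycle twice more (an even number of extra letters keeps the length
-- of the first component even) yields an accepted word encoding (4^L − 1, 2^(2L−1) − 2^(K−1)) with
-- L > K, whereas sum_rs(4^L − 1) = 2^(2L−1) − 2^(L−1).
-- The closed form comes from the sums S k and S′ k of rs over [0, 2^k) and [2^k, 2^(k+1)).  Since
-- rs(2^(k+1) + i) = rs(i) and rs(3·2^k + i) = 1 − rs(2^k + i) for i < 2^k, they satisfy
-- S(k+1) = S k + S′ k and S′(k+1) + S′ k = S k + 2^k, so S′ k = S k propagates from k to k + 2.

{-# OPTIONS --safe #-}
module Submission where

open import Defs
open import Data.Nat
open import Data.Nat.Properties
open import Data.Nat.DivMod
open import Data.Nat.Divisibility using (m∣m*n)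
open import Data.Nat.Tactic.RingSolver using (solve-∀)
open import Data.Parity.Base as ℙ using (Parity; 0ℙ; 1ℙ)
import Data.Parity.Properties as ℙ
open import Data.Sum using (_⊎_; inj₁; inj₂)
open import Data.Bool using (Bool; true; false; T)
open import Data.List using (List; []; _∷_; _∷ʳ_; _++_; replicate; reverse; map; zip; length; foldl)
open import Data.List.Properties
  using (foldl-++; unfold-reverse; reverse-++; reverse-map; map-++; map-replicate; length-replicate; length-++; ++-identityʳ)
open import Data.Product using (_×_; _,_; ∃₂)
open import Data.Fin using (Fin; toℕ)
open import Data.Fin.Properties using (pigeonhole)
open import Data.Nat.GeneralisedArithmetic using (iterate)
open import Function using (_∘_)
open import Function.Bundles using (Equivalence)
open import Relation.Binary.PropositionalEquality
  using (_≡_; _≢_; refl; sym; trans; cong; cong₂; subst; module ≡-Reasoning)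
open import Relation.Nullary using (¬_)

-- rsF and bitsF in Defs are of the form g, where g f n is computed with fuel f.
module _ {A : Set} (F : (ℕ → A) → ℕ → A) (g : ℕ → ℕ → A)
         (F-local : ∀ {r r′} n → (∀ {x} → x < n → r x ≡ r′ x) → F r n ≡ F r′ n)
         (g-zero : ∀ r → g 0 0 ≡ F r 0)
         (g-suc : ∀ f n → g (suc f) n ≡ F (g f) n) where

  fuel-irrelevant : ∀ {f f′ n} → n ≤ f → n ≤ f′ → g f n ≡ g f′ n
  fuel-irrelevant {zero}  {zero}   z≤n z≤n = refl
  fuel-irrelevant {zero}  {suc f′} z≤n _   = trans (g-zero (g f′)) (sym (g-suc f′ 0))
  fuel-irrelevant {suc f} {zero}   _   z≤n = trans (g-suc f 0) (sym (g-zero (g f)))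
  fuel-irrelevant {suc f} {suc f′} {n} n≤1+f n≤1+f′ = begin
    g (suc f) n   ≡⟨ g-suc f n ⟩
    F (g f) n     ≡⟨ F-local n (λ x<n → fuel-irrelevant (below x<n n≤1+f) (below x<n n≤1+f′)) ⟩
    F (g f′) n    ≡⟨ sym (g-suc f′ n) ⟩
    g (suc f′) n  ∎
    where
    open ≡-Reasoning
    below : ∀ {x h} → x < n → n ≤ suc h → x ≤ h
    below x<n n≤1+h = ≤-pred (≤-trans x<n n≤1+h)

  diagonal-fixpoint : ∀ n → g n n ≡ F (λ x → g x x) n
  diagonal-fixpoint zero    = g-zero _
  diagonal-fixpoint (suc n) =
    trans (g-suc n (suc n)) (F-local (suc n) (λ x<1+n → fuel-irrelevant (≤-pred x<1+n) ≤-refl))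

[r+dq]%d≡r : ∀ d q {r} .{{_ : NonZero d}} → r < d → (r + d * q) % d ≡ r
[r+dq]%d≡r d q {r} r<d = trans (%-remove-+ʳ r (m∣m*n q)) (m<n⇒m%n≡m r<d)

[r+dq]/d≡q : ∀ d q {r} .{{_ : NonZero d}} → r < d → (r + d * q) / d ≡ q
[r+dq]/d≡q d q {r} r<d = begin
  (r + d * q) / d    ≡⟨ +-distrib-/-∣ʳ r (m∣m*n q) ⟩
  r / d + d * q / d  ≡⟨ cong₂ _+_ (m<n⇒m/n≡0 r<d) (trans (cong (_/ d) (*-comm d q)) (m*n/n≡m q d)) ⟩
  q                  ∎
  where open ≡-Reasoning

-- The Rudin–Shapiro recurrences

-- Mirrors the clauses of rsF (residues ≥ 3 share the last one), so that rsF-suc holds by computation.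
byResidue : (ℕ → ℕ) → ℕ → ℕ → ℕ
byResidue r n 0 = r (n / 2)
byResidue r n 1 = r (n / 4)
byResidue r n 2 = r (n / 2)
byResidue r n (suc (suc (suc _))) = 1 ∸ r (2 * (n / 4) + 1)

rsStep : (ℕ → ℕ) → ℕ → ℕ
rsStep r 0 = 0
rsStep r 1 = 0
rsStep r n@(suc (suc _)) = byResidue r n (n % 4)

rsF-suc : ∀ f n → rsF (suc f) n ≡ rsStep (rsF f) n
rsF-suc f 0 = refl
rsF-suc f 1 = refl
rsF-suc f n@(suc (suc _)) with n % 4
... | 0 = refl
... | 1 = refl
... | 2 = refl
... | suc (suc (suc _)) = refl

2[n/4]+1<n : ∀ n → 2 ≤ n → 2 * (n / 4) + 1 < n
2[n/4]+1<n n 2≤n with n / 4 in n/4≡q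
... | zero  = 2≤n
... | suc q = begin-strict
  2 * suc q + 1                <⟨ m≤m+n (suc (2 * suc q + 1)) (2 * q) ⟩
  suc (2 * suc q + 1) + 2 * q  ≡⟨ regroup q ⟩
  suc q * 4                    ≡⟨ cong (_* 4) (sym n/4≡q) ⟩
  n / 4 * 4                    ≤⟨ m/n*n≤m n 4 ⟩
  n                            ∎
  where
  open ≤-Reasoning
  regroup : ∀ q → suc (2 * suc q + 1) + 2 * q ≡ suc q * 4
  regroup = solve-∀

byResidue-local : ∀ {r r′} k c → (∀ {x} → x < 2 + k → r x ≡ r′ x) →
                  byResidue r (2 + k) c ≡ byResidue r′ (2 + k) c
byResidue-local k 0 agree = agree (m/n<m (2 + k) 2 ≤-refl)
byResidue-local k 1 agree = agree (m/n<m (2 + k) 4 (s≤s (s≤s z≤n)))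
byResidue-local k 2 agree = agree (m/n<m (2 + k) 2 ≤-refl)
byResidue-local k (suc (suc (suc _))) agree = cong (1 ∸_) (agree (2[n/4]+1<n (2 + k) (s≤s (s≤s z≤n))))

rsStep-local : ∀ {r r′} n → (∀ {x} → x < n → r x ≡ r′ x) → rsStep r n ≡ rsStep r′ n
rsStep-local 0 _ = refl
rsStep-local 1 _ = refl
rsStep-local (suc (suc k)) agree = byResidue-local k ((2 + k) % 4) agree

rs-fixpoint : ∀ n → rs n ≡ rsStep rs n
rs-fixpoint = diagonal-fixpoint rsStep rsF rsStep-local (λ _ → refl) rsF-suc

rs-byResidue : ∀ n → 2 ≤ n → rs n ≡ byResidue rs n (n % 4)
rs-byResidue 1 (s≤s ())
rs-byResidue (suc (suc k)) _ = rs-fixpoint (2 + k)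

[2n]%4∈0,2 : ∀ n → (2 * n) % 4 ≡ 0 ⊎ (2 * n) % 4 ≡ 2
[2n]%4∈0,2 n = subst (λ x → x ≡ 0 ⊎ x ≡ 2) (sym (%-distribˡ-* 2 n 4)) (by-residue (n % 4) (m%n<n n 4))
  where
  by-residue : ∀ c → c < 4 → (2 * c) % 4 ≡ 0 ⊎ (2 * c) % 4 ≡ 2
  by-residue 0 _ = inj₁ refl
  by-residue 1 _ = inj₂ refl
  by-residue 2 _ = inj₁ refl
  by-residue 3 _ = inj₂ refl
  by-residue (suc (suc (suc (suc _)))) (s≤s (s≤s (s≤s (s≤s ()))))

byResidue-even : ∀ r n {c} → c ≡ 0 ⊎ c ≡ 2 → byResidue r n c ≡ r (n / 2)
byResidue-even r n (inj₁ refl) = refl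
byResidue-even r n (inj₂ refl) = refl

rs-2n : ∀ n → rs (2 * n) ≡ rs n
rs-2n zero    = refl
rs-2n n@(suc _) = begin
  rs (2 * n)                             ≡⟨ rs-byResidue (2 * n) (*-monoʳ-≤ 2 (s≤s z≤n)) ⟩
  byResidue rs (2 * n) ((2 * n) % 4)     ≡⟨ byResidue-even rs (2 * n) ([2n]%4∈0,2 n) ⟩
  rs ((2 * n) / 2)                       ≡⟨ cong rs ([r+dq]/d≡q 2 n (s≤s z≤n)) ⟩
  rs n                                   ∎
  where open ≡-Reasoning

rs-4n+1 : ∀ n → rs (4 * n + 1) ≡ rs n
rs-4n+1 zero    = refl
rs-4n+1 n@(suc _) = begin
  rs (4 * n + 1)
    ≡⟨ cong rs (+-comm (4 * n) 1) ⟩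
  rs (1 + 4 * n)
    ≡⟨ rs-byResidue (1 + 4 * n) (s≤s (s≤s z≤n)) ⟩
  byResidue rs (1 + 4 * n) ((1 + 4 * n) % 4)
    ≡⟨ cong (byResidue rs (1 + 4 * n)) ([r+dq]%d≡r 4 n (s≤s (s≤s z≤n))) ⟩
  rs ((1 + 4 * n) / 4)
    ≡⟨ cong rs ([r+dq]/d≡q 4 n (s≤s (s≤s z≤n))) ⟩
  rs n ∎
  where open ≡-Reasoning

rs-4n+3 : ∀ n → rs (4 * n + 3) ≡ 1 ∸ rs (2 * n + 1)
rs-4n+3 n = begin
  rs (4 * n + 3)                         ≡⟨ cong rs (+-comm (4 * n) 3) ⟩
  rs (3 + 4 * n)                         ≡⟨ rs-byResidue (3 + 4 * n) (s≤s (s≤s z≤n)) ⟩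
  byResidue rs (3 + 4 * n) ((3 + 4 * n) % 4) ≡⟨ cong (byResidue rs (3 + 4 * n)) ([r+dq]%d≡r 4 n ≤-refl) ⟩
  1 ∸ rs (2 * ((3 + 4 * n) / 4) + 1)     ≡⟨ cong (λ q → 1 ∸ rs (2 * q + 1)) ([r+dq]/d≡q 4 n ≤-refl) ⟩
  1 ∸ rs (2 * n + 1)                     ∎
  where open ≡-Reasoning

data Halves : ℕ → Set where
  even : ∀ m → Halves (2 * m)
  odd  : ∀ m → Halves (1 + 2 * m)

halves : ∀ n → Halves n
halves zero = even 0
halves (suc n) with halves n
... | even m = odd m
... | odd m  = subst Halves (*-suc 2 m) (even (suc m))

flipIf : Parity → ℕ → ℕ
flipIf 0ℙ x = x
flipIf 1ℙ x = 1 ∸ x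

flipIf-complement : ∀ p {x y} → x + y ≡ 1 → flipIf p x + flipIf p y ≡ 1
flipIf-complement 0ℙ x+y≡1 = x+y≡1
flipIf-complement 1ℙ {0} {1} _ = refl
flipIf-complement 1ℙ {1} {0} _ = refl
flipIf-complement 1ℙ {0} {0} ()
flipIf-complement 1ℙ {0} {suc (suc _)} ()
flipIf-complement 1ℙ {1} {suc _} ()
flipIf-complement 1ℙ {suc (suc _)} ()

parity-2*+ : ∀ a b → parity (2 * a + b) ≡ parity b
parity-2*+ a b = trans (ℙ.+-homo-+ (2 * a) b) (cong (ℙ._+ parity b) (ℙ.*-homo-* 2 a))

rs-1+2n : ∀ a → rs (1 + 2 * a) ≡ flipIf (parity a) (rs a)
rs-1+2n a with halves a
... | even j = begin
  rs (1 + 2 * (2 * j))                ≡⟨ cong rs (regroup j) ⟩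
  rs (4 * j + 1)                      ≡⟨ rs-4n+1 j ⟩
  rs j                                ≡⟨ sym (rs-2n j) ⟩
  rs (2 * j)                          ≡⟨ cong (λ p → flipIf p (rs (2 * j))) (sym (ℙ.*-homo-* 2 j)) ⟩
  flipIf (parity (2 * j)) (rs (2 * j)) ∎
  where
  open ≡-Reasoning
  regroup : ∀ j → 1 + 2 * (2 * j) ≡ 4 * j + 1
  regroup = solve-∀
... | odd j = begin
  rs (1 + 2 * (1 + 2 * j))            ≡⟨ cong rs (regroup j) ⟩
  rs (4 * j + 3)                      ≡⟨ rs-4n+3 j ⟩
  1 ∸ rs (2 * j + 1)                  ≡⟨ cong (λ n → 1 ∸ rs n) (+-comm (2 * j) 1) ⟩
  1 ∸ rs (1 + 2 * j)                  ≡⟨ cong (λ p → flipIf p (rs (1 + 2 * j))) (sym parity-odd) ⟩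
  flipIf (parity (1 + 2 * j)) (rs (1 + 2 * j)) ∎
  where
  open ≡-Reasoning
  regroup : ∀ j → 1 + 2 * (1 + 2 * j) ≡ 4 * j + 3
  regroup = solve-∀
  parity-odd : parity (1 + 2 * j) ≡ 1ℙ
  parity-odd = trans (ℙ.+-homo-+ 1 (2 * j)) (cong ℙ._⁻¹ (ℙ.*-homo-* 2 j))

-- Sums over dyadic blocks

rs-2^[1+k]+ : ∀ k {i} → i < 2 ^ k → rs (2 ^ suc k + i) ≡ rs i
rs-2^[1+k]+ zero {zero} _ = refl
rs-2^[1+k]+ zero {suc _} (s≤s ())
rs-2^[1+k]+ (suc k) {i} i<2P with halves i
... | even m = begin
  rs (2 * P + 2 * m)   ≡⟨ cong rs (sym (*-distribˡ-+ 2 P m)) ⟩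
  rs (2 * (P + m))     ≡⟨ rs-2n (P + m) ⟩
  rs (P + m)           ≡⟨ rs-2^[1+k]+ k (*-cancelˡ-< 2 m (2 ^ k) i<2P) ⟩
  rs m                 ≡⟨ sym (rs-2n m) ⟩
  rs (2 * m)           ∎
  where
  open ≡-Reasoning
  P = 2 ^ suc k
... | odd m = begin
  rs (2 * P + (1 + 2 * m))               ≡⟨ cong rs (regroup P m) ⟩
  rs (1 + 2 * (P + m))                   ≡⟨ rs-1+2n (P + m) ⟩
  flipIf (parity (P + m)) (rs (P + m))   ≡⟨ cong₂ flipIf (parity-2*+ (2 ^ k) m) (rs-2^[1+k]+ k m<2^k) ⟩
  flipIf (parity m) (rs m)               ≡⟨ sym (rs-1+2n m) ⟩
  rs (1 + 2 * m)                         ∎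
  where
  open ≡-Reasoning
  P = 2 ^ suc k
  regroup : ∀ a b → 2 * a + (1 + 2 * b) ≡ 1 + 2 * (a + b)
  regroup = solve-∀
  m<2^k : m < 2 ^ k
  m<2^k = *-cancelˡ-< 2 m (2 ^ k) (<-trans (n<1+n (2 * m)) i<2P)

rs-complement : ∀ k {i} → i < 2 ^ k → rs (2 ^ suc k + 2 ^ k + i) + rs (2 ^ k + i) ≡ 1
rs-complement zero {zero} _ = refl
rs-complement zero {suc _} (s≤s ())
rs-complement (suc k) {i} i<2Q with halves i
... | even m = begin
  rs (2 * Q + Q + 2 * m) + rs (Q + 2 * m)
    ≡⟨ cong₂ (λ a b → rs a + rs b) (regroup Q P m) (sym (*-distribˡ-+ 2 P m)) ⟩
  rs (2 * (Q + P + m)) + rs (2 * (P + m))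
    ≡⟨ cong₂ _+_ (rs-2n (Q + P + m)) (rs-2n (P + m)) ⟩
  rs (Q + P + m) + rs (P + m)
    ≡⟨ rs-complement k (*-cancelˡ-< 2 m P i<2Q) ⟩
  1 ∎
  where
  open ≡-Reasoning
  P = 2 ^ k
  Q = 2 ^ suc k
  regroup : ∀ a b c → 2 * a + 2 * b + 2 * c ≡ 2 * (a + b + c)
  regroup = solve-∀
... | odd m = begin
  rs (2 * Q + Q + (1 + 2 * m)) + rs (Q + (1 + 2 * m))
    ≡⟨ cong₂ (λ a b → rs a + rs b) (regroup₃ Q P m) (regroup₂ P m) ⟩
  rs (1 + 2 * (Q + P + m)) + rs (1 + 2 * (P + m))
    ≡⟨ cong₂ _+_ (rs-1+2n (Q + P + m)) (rs-1+2n (P + m)) ⟩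
  flipIf (parity (Q + P + m)) (rs (Q + P + m)) + flipIf (parity (P + m)) (rs (P + m))
    ≡⟨ cong (λ p → flipIf p (rs (Q + P + m)) + flipIf (parity (P + m)) (rs (P + m))) same-parity ⟩
  flipIf (parity (P + m)) (rs (Q + P + m)) + flipIf (parity (P + m)) (rs (P + m))
    ≡⟨ flipIf-complement (parity (P + m)) (rs-complement k m<P) ⟩
  1 ∎
  where
  open ≡-Reasoning
  P = 2 ^ k
  Q = 2 ^ suc k
  regroup₂ : ∀ a b → 2 * a + (1 + 2 * b) ≡ 1 + 2 * (a + b)
  regroup₂ = solve-∀
  regroup₃ : ∀ a b c → 2 * a + 2 * b + (1 + 2 * c) ≡ 1 + 2 * (a + b + c)
  regroup₃ = solve-∀
  same-parity : parity (Q + P + m) ≡ parity (P + m)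
  same-parity = trans (cong parity (+-assoc Q P m)) (parity-2*+ P (P + m))
  m<P : m < P
  m<P = *-cancelˡ-< 2 m P (<-trans (n<1+n (2 * m)) i<2Q)

blockSum : ℕ → ℕ → ℕ
blockSum a zero    = 0
blockSum a (suc l) = blockSum a l + rs (a + l)

sumRS≡blockSum : ∀ n → sumRS n ≡ blockSum 0 (suc n)
sumRS≡blockSum zero    = refl
sumRS≡blockSum (suc n) = cong (_+ rs (suc n)) (sumRS≡blockSum n)

blockSum-+ : ∀ a x y → blockSum a (x + y) ≡ blockSum a x + blockSum (a + x) y
blockSum-+ a x zero    = trans (cong (blockSum a) (+-identityʳ x)) (sym (+-identityʳ _))
blockSum-+ a x (suc y) = begin
  blockSum a (x + suc y)
    ≡⟨ cong (blockSum a) (+-suc x y) ⟩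
  blockSum a (x + y) + rs (a + (x + y))
    ≡⟨ cong₂ _+_ (blockSum-+ a x y) (cong rs (sym (+-assoc a x y))) ⟩
  blockSum a x + blockSum (a + x) y + rs (a + x + y)
    ≡⟨ +-assoc (blockSum a x) _ _ ⟩
  blockSum a x + (blockSum (a + x) y + rs (a + x + y)) ∎
  where open ≡-Reasoning

blockSum-cong : ∀ a b l → (∀ {i} → i < l → rs (a + i) ≡ rs (b + i)) → blockSum a l ≡ blockSum b l
blockSum-cong a b zero    _     = refl
blockSum-cong a b (suc l) agree = cong₂ _+_ (blockSum-cong a b l (agree ∘ m<n⇒m<1+n)) (agree ≤-refl)

blockSum-complement : ∀ a b l → (∀ {i} → i < l → rs (a + i) + rs (b + i) ≡ 1) →
                      blockSum a l + blockSum b l ≡ l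
blockSum-complement a b zero    _    = refl
blockSum-complement a b (suc l) comp = begin
  blockSum a l + rs (a + l) + (blockSum b l + rs (b + l))
    ≡⟨ interchange (blockSum a l) (rs (a + l)) (blockSum b l) (rs (b + l)) ⟩
  (blockSum a l + blockSum b l) + (rs (a + l) + rs (b + l))
    ≡⟨ cong₂ _+_ (blockSum-complement a b l (λ i<l → comp (m<n⇒m<1+n i<l))) (comp ≤-refl) ⟩
  l + 1
    ≡⟨ +-comm l 1 ⟩
  suc l ∎
  where
  open ≡-Reasoning
  interchange : ∀ a b c d → a + b + (c + d) ≡ (a + c) + (b + d)
  interchange = solve-∀

S S′ : ℕ → ℕ
S  k = blockSum 0 (2 ^ k)
S′ k = blockSum (2 ^ k) (2 ^ k)

S-suc : ∀ k → S (suc k) ≡ S k + S′ k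
S-suc k = trans (cong (blockSum 0) (cong (2 ^ k +_) (+-identityʳ (2 ^ k)))) (blockSum-+ 0 (2 ^ k) (2 ^ k))

S′-suc : ∀ k → S′ (suc k) + S′ k ≡ S k + 2 ^ k
S′-suc k = begin
  blockSum Q Q + blockSum P P
    ≡⟨ cong (λ l → blockSum Q l + blockSum P P) (cong (P +_) (+-identityʳ P)) ⟩
  blockSum Q (P + P) + blockSum P P
    ≡⟨ cong (_+ blockSum P P) (blockSum-+ Q P P) ⟩
  blockSum Q P + blockSum (Q + P) P + blockSum P P
    ≡⟨ +-assoc (blockSum Q P) _ _ ⟩
  blockSum Q P + (blockSum (Q + P) P + blockSum P P)
    ≡⟨ cong₂ _+_ (blockSum-cong Q 0 P (rs-2^[1+k]+ k)) (blockSum-complement (Q + P) P P (rs-complement k)) ⟩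
  S k + P ∎
  where
  open ≡-Reasoning
  P = 2 ^ k
  Q = 2 ^ suc k

module _ {k} (balanced : S′ k ≡ S k) where

  S′-suc-balanced : S′ (suc k) ≡ 2 ^ k
  S′-suc-balanced = +-cancelʳ-≡ (S k) _ _ (begin
    S′ (suc k) + S k   ≡⟨ cong (S′ (suc k) +_) (sym balanced) ⟩
    S′ (suc k) + S′ k  ≡⟨ S′-suc k ⟩
    S k + 2 ^ k        ≡⟨ +-comm (S k) (2 ^ k) ⟩
    2 ^ k + S k        ∎)
    where open ≡-Reasoning

  S-2+-balanced : S (2 + k) ≡ 2 * S k + 2 ^ k
  S-2+-balanced = begin
    S (2 + k)                 ≡⟨ S-suc (suc k) ⟩
    S (suc k) + S′ (suc k)    ≡⟨ cong₂ _+_ (trans (S-suc k) (cong (S k +_) balanced)) S′-suc-balanced ⟩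
    S k + S k + 2 ^ k         ≡⟨ cong (λ x → S k + x + 2 ^ k) (sym (+-identityʳ (S k))) ⟩
    2 * S k + 2 ^ k           ∎
    where open ≡-Reasoning

  balanced-2+ : S′ (2 + k) ≡ S (2 + k)
  balanced-2+ = +-cancelʳ-≡ (2 ^ k) _ _ (begin
    S′ (2 + k) + 2 ^ k               ≡⟨ cong (S′ (2 + k) +_) (sym S′-suc-balanced) ⟩
    S′ (2 + k) + S′ (suc k)          ≡⟨ S′-suc (suc k) ⟩
    S (suc k) + 2 ^ suc k            ≡⟨ cong (_+ 2 ^ suc k) (trans (S-suc k) (cong (S k +_) balanced)) ⟩
    S k + S k + 2 * 2 ^ k            ≡⟨ regroup (S k) (2 ^ k) ⟩
    2 * S k + 2 ^ k + 2 ^ k          ≡⟨ cong (_+ 2 ^ k) (sym S-2+-balanced) ⟩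
    S (2 + k) + 2 ^ k                ∎)
    where
    open ≡-Reasoning
    regroup : ∀ s p → s + s + 2 * p ≡ 2 * s + p + p
    regroup = solve-∀

balanced-even : ∀ j → S′ (2 * j) ≡ S (2 * j)
balanced-even zero = refl
balanced-even (suc j) = subst (λ n → S′ n ≡ S n) (sym (*-suc 2 j)) (balanced-2+ {2 * j} (balanced-even j))

S-even : ∀ j → 2 * S (2 * j) + 2 ^ j ≡ 2 ^ (2 * j)
S-even zero = refl
S-even (suc j) = begin
  2 * S (2 * suc j) + 2 ^ suc j
    ≡⟨ cong (λ n → 2 * S n + 2 ^ suc j) (*-suc 2 j) ⟩
  2 * S (2 + 2 * j) + 2 * 2 ^ j
    ≡⟨ cong (λ x → 2 * x + 2 * 2 ^ j) (S-2+-balanced {2 * j} (balanced-even j)) ⟩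
  2 * (2 * s + 2 ^ (2 * j)) + 2 * 2 ^ j
    ≡⟨ regroup s (2 ^ j) (2 ^ (2 * j)) ⟩
  2 * (2 * s + 2 ^ j) + 2 * 2 ^ (2 * j)
    ≡⟨ cong (λ x → 2 * x + 2 * 2 ^ (2 * j)) (S-even j) ⟩
  2 * 2 ^ (2 * j) + 2 * 2 ^ (2 * j)
    ≡⟨ double (2 ^ (2 * j)) ⟩
  2 ^ (2 + 2 * j)
    ≡⟨ cong (2 ^_) (sym (*-suc 2 j)) ⟩
  2 ^ (2 * suc j) ∎
  where
  open ≡-Reasoning
  s = S (2 * j)
  regroup : ∀ s p q → 2 * (2 * s + q) + 2 * p ≡ 2 * (2 * s + p) + 2 * q
  regroup = solve-∀
  double : ∀ q → 2 * q + 2 * q ≡ 2 * (2 * q)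
  double = solve-∀

-- Binary expansions

bitOf : ℕ → Bool
bitOf zero    = false
bitOf (suc _) = true

bitsStep : (ℕ → List Bool) → ℕ → List Bool
bitsStep r zero        = []
bitsStep r n@(suc _)   = bitOf (n % 2) ∷ r (n / 2)

bitsF-suc : ∀ f n → bitsF (suc f) n ≡ bitsStep (bitsF f) n
bitsF-suc f zero = refl
bitsF-suc f n@(suc _) with n % 2
... | zero  = refl
... | suc _ = refl

bitsStep-local : ∀ {r r′} n → (∀ {x} → x < n → r x ≡ r′ x) → bitsStep r n ≡ bitsStep r′ n
bitsStep-local zero      _     = refl
bitsStep-local (suc k)   agree = cong (_ ∷_) (agree (m/n<m (suc k) 2 ≤-refl))

bitsLSB-fixpoint : ∀ n → bitsLSB n ≡ bitsStep bitsLSB n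
bitsLSB-fixpoint = diagonal-fixpoint bitsStep bitsF bitsStep-local (λ _ → refl) bitsF-suc

bitsLSB-1+2n : ∀ n → bitsLSB (1 + 2 * n) ≡ true ∷ bitsLSB n
bitsLSB-1+2n n = trans (bitsLSB-fixpoint (1 + 2 * n))
  (cong₂ (λ c q → bitOf c ∷ bitsLSB q) ([r+dq]%d≡r 2 n ≤-refl) ([r+dq]/d≡q 2 n ≤-refl))

bitsLSB-2n : ∀ n .{{_ : NonZero n}} → bitsLSB (2 * n) ≡ false ∷ bitsLSB n
bitsLSB-2n n@(suc _) = trans (bitsLSB-fixpoint (2 * n))
  (cong₂ (λ c q → bitOf c ∷ bitsLSB q) ([r+dq]%d≡r 2 n (s≤s z≤n)) ([r+dq]/d≡q 2 n (s≤s z≤n)))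

bitsLSB-*2^ : ∀ n M .{{_ : NonZero n}} → bitsLSB (n * 2 ^ M) ≡ replicate M false ++ bitsLSB n
bitsLSB-*2^ n zero    = cong bitsLSB (*-identityʳ n)
bitsLSB-*2^ n (suc M) {{n≢0}} = begin
  bitsLSB (n * (2 * 2 ^ M))          ≡⟨ cong bitsLSB (*-comm-middle n 2 (2 ^ M)) ⟩
  bitsLSB (2 * (n * 2 ^ M))          ≡⟨ bitsLSB-2n (n * 2 ^ M) {{m*n≢0 n (2 ^ M) {{n≢0}} {{m^n≢0 2 M}}}} ⟩
  false ∷ bitsLSB (n * 2 ^ M)        ≡⟨ cong (false ∷_) (bitsLSB-*2^ n M) ⟩
  false ∷ replicate M false ++ bitsLSB n ∎
  where
  open ≡-Reasoning
  *-comm-middle : ∀ a b c → a * (b * c) ≡ b * (a * c)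
  *-comm-middle = solve-∀

ones : ℕ → ℕ
ones zero    = 0
ones (suc L) = 1 + 2 * ones L

bitsLSB-ones : ∀ L → bitsLSB (ones L) ≡ replicate L true
bitsLSB-ones zero    = refl
bitsLSB-ones (suc L) = trans (bitsLSB-1+2n (ones L)) (cong (true ∷_) (bitsLSB-ones L))

1+ones≡2^ : ∀ L → 1 + ones L ≡ 2 ^ L
1+ones≡2^ zero    = refl
1+ones≡2^ (suc L) = trans (sym (*-suc 2 (ones L))) (cong (2 *_) (1+ones≡2^ L))

ones*2^+2^ : ∀ J M → ones J * 2 ^ M + 2 ^ M ≡ 2 ^ (J + M)
ones*2^+2^ J M = begin
  ones J * 2 ^ M + 2 ^ M     ≡⟨ +-comm (ones J * 2 ^ M) (2 ^ M) ⟩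
  (1 + ones J) * 2 ^ M       ≡⟨ cong (_* 2 ^ M) (1+ones≡2^ J) ⟩
  2 ^ J * 2 ^ M              ≡⟨ sym (^-distribˡ-+-* 2 J M) ⟩
  2 ^ (J + M)                ∎
  where open ≡-Reasoning

module _ {A : Set} where

  replicate-∷ʳ : ∀ n (x : A) → replicate n x ∷ʳ x ≡ x ∷ replicate n x
  replicate-∷ʳ zero    x = refl
  replicate-∷ʳ (suc n) x = cong (x ∷_) (replicate-∷ʳ n x)

  reverse-replicate : ∀ n (x : A) → reverse (replicate n x) ≡ replicate n x
  reverse-replicate zero    x = refl
  reverse-replicate (suc n) x = begin
    reverse (x ∷ replicate n x)     ≡⟨ unfold-reverse x (replicate n x) ⟩
    reverse (replicate n x) ∷ʳ x    ≡⟨ cong (_∷ʳ x) (reverse-replicate n x) ⟩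
    replicate n x ∷ʳ x              ≡⟨ replicate-∷ʳ n x ⟩
    x ∷ replicate n x               ∎
    where open ≡-Reasoning

  zip-replicateˡ : ∀ {B : Set} {n} (a : A) (ys : List B) → length ys ≡ n →
                   zip (replicate n a) ys ≡ map (a ,_) ys
  zip-replicateˡ a []       refl = refl
  zip-replicateˡ a (y ∷ ys) refl = cong ((a , y) ∷_) (zip-replicateˡ a ys refl)

pairWord-ones : ∀ m L → length (bitsLSB m) ≡ L →
                pairWord (ones (suc L)) m ≡ (true , false) ∷ map (true ,_) (reverse (bitsLSB m))
pairWord-ones m L ∣m∣≡L = begin
  reverse (zip (padLSB W (ones (suc L))) (padLSB W m))
    ≡⟨ cong (λ w → reverse (zip (padLSB w (ones (suc L))) (padLSB w m))) W≡1+L ⟩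
  reverse (zip (padLSB (suc L) (ones (suc L))) (padLSB (suc L) m))
    ≡⟨ cong₂ (λ xs ys → reverse (zip xs ys)) pad-ones pad-m ⟩
  reverse (zip (replicate (suc L) true) (bs ++ false ∷ []))
    ≡⟨ cong reverse (zip-replicateˡ true (bs ++ false ∷ []) ∣bs∷ʳfalse∣) ⟩
  reverse (map (true ,_) (bs ++ false ∷ []))
    ≡⟨ sym (reverse-map (true ,_) (bs ++ false ∷ [])) ⟩
  map (true ,_) (reverse (bs ++ false ∷ []))
    ≡⟨ cong (map (true ,_)) (reverse-++ bs (false ∷ [])) ⟩
  (true , false) ∷ map (true ,_) (reverse bs) ∎
  where
  open ≡-Reasoning
  bs = bitsLSB m
  ∣ones∣ : length (bitsLSB (ones (suc L))) ≡ suc L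
  ∣ones∣ = trans (cong length (bitsLSB-ones (suc L))) (length-replicate (suc L))
  W = length (bitsLSB (ones (suc L))) ⊔ length bs
  W≡1+L : W ≡ suc L
  W≡1+L = trans (cong₂ _⊔_ ∣ones∣ ∣m∣≡L) (m≥n⇒m⊔n≡m (n≤1+n L))
  pad-ones : padLSB (suc L) (ones (suc L)) ≡ replicate (suc L) true
  pad-ones = begin
    bitsLSB (ones (suc L)) ++ replicate (suc L ∸ length (bitsLSB (ones (suc L)))) false
      ≡⟨ cong₂ (λ xs k → xs ++ replicate (suc L ∸ k) false) (bitsLSB-ones (suc L)) ∣ones∣ ⟩
    replicate (suc L) true ++ replicate (suc L ∸ suc L) false
      ≡⟨ cong (λ k → replicate (suc L) true ++ replicate k false) (n∸n≡0 (suc L)) ⟩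
    replicate (suc L) true ++ []
      ≡⟨ ++-identityʳ _ ⟩
    replicate (suc L) true ∎
  pad-m : padLSB (suc L) m ≡ bs ++ false ∷ []
  pad-m = trans (cong (λ k → bs ++ replicate (suc L ∸ k) false) ∣m∣≡L)
                (cong (λ k → bs ++ replicate k false) (m+n∸n≡m 1 L))
  ∣bs∷ʳfalse∣ : length (bs ++ false ∷ []) ≡ suc L
  ∣bs∷ʳfalse∣ = trans (length-++ bs) (trans (cong (_+ 1) ∣m∣≡L) (+-comm L 1))

stairWord : ℕ → ℕ → List (Bool × Bool)
stairWord J M = (true , false) ∷ replicate J (true , true) ++ replicate M (true , false)

pairWord-stair : ∀ J M .{{_ : NonZero J}} →
  pairWord (ones (suc (J + M))) (ones J * 2 ^ M) ≡ stairWord J M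
pairWord-stair J@(suc _) M = begin
  pairWord (ones (suc (J + M))) m
    ≡⟨ pairWord-ones m (J + M) ∣m∣≡J+M ⟩
  (true , false) ∷ map (true ,_) (reverse (bitsLSB m))
    ≡⟨ cong (λ bs → (true , false) ∷ map (true ,_) (reverse bs)) bits-m ⟩
  (true , false) ∷ map (true ,_) (reverse (replicate M false ++ replicate J true))
    ≡⟨ cong (λ bs → (true , false) ∷ map (true ,_) bs) (reverse-++ (replicate M false) (replicate J true)) ⟩
  (true , false) ∷ map (true ,_) (reverse (replicate J true) ++ reverse (replicate M false))
    ≡⟨ cong₂ (λ xs ys → (true , false) ∷ map (true ,_) (xs ++ ys)) (reverse-replicate J true) (reverse-replicate M false) ⟩
  (true , false) ∷ map (true ,_) (replicate J true ++ replicate M false)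
    ≡⟨ cong ((true , false) ∷_) (map-++ (true ,_) (replicate J true) (replicate M false)) ⟩
  (true , false) ∷ map (true ,_) (replicate J true) ++ map (true ,_) (replicate M false)
    ≡⟨ cong₂ (λ xs ys → (true , false) ∷ xs ++ ys) (map-replicate (true ,_) J true) (map-replicate (true ,_) M false) ⟩
  stairWord J M ∎
  where
  open ≡-Reasoning
  m = ones J * 2 ^ M
  bits-m : bitsLSB m ≡ replicate M false ++ replicate J true
  bits-m = trans (bitsLSB-*2^ (ones J) M) (cong (replicate M false ++_) (bitsLSB-ones J))
  ∣m∣≡J+M : length (bitsLSB m) ≡ J + M
  ∣m∣≡J+M = begin
    length (bitsLSB m)
      ≡⟨ cong length bits-m ⟩
    length (replicate M false ++ replicate J true)
      ≡⟨ length-++ (replicate M false) ⟩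
    length (replicate M false) + length (replicate J true)
      ≡⟨ cong₂ _+_ (length-replicate M) (length-replicate J) ⟩
    M + J
      ≡⟨ +-comm M J ⟩
    J + M ∎

sumRS-ones : ∀ L → sumRS (ones L) ≡ S L
sumRS-ones L = trans (sumRS≡blockSum (ones L)) (cong (blockSum 0) (1+ones≡2^ L))

stair-value : ∀ J M j → suc (J + M) ≡ 2 * j →
              2 * (ones J * 2 ^ M) + 2 ^ suc M ≡ 2 * sumRS (ones (suc (J + M))) + 2 ^ j
stair-value J M j L≡2j = begin
  2 * (ones J * 2 ^ M) + 2 * 2 ^ M
    ≡⟨ sym (*-distribˡ-+ 2 (ones J * 2 ^ M) (2 ^ M)) ⟩
  2 * (ones J * 2 ^ M + 2 ^ M)
    ≡⟨ cong (2 *_) (ones*2^+2^ J M) ⟩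
  2 ^ suc (J + M)
    ≡⟨ cong (2 ^_) L≡2j ⟩
  2 ^ (2 * j)
    ≡⟨ sym (S-even j) ⟩
  2 * S (2 * j) + 2 ^ j
    ≡⟨ cong (λ L → 2 * S L + 2 ^ j) (sym L≡2j) ⟩
  2 * S (suc (J + M)) + 2 ^ j
    ≡⟨ cong (λ s → 2 * s + 2 ^ j) (sym (sumRS-ones (suc (J + M)))) ⟩
  2 * sumRS (ones (suc (J + M))) + 2 ^ j ∎
  where open ≡-Reasoning

sumRS-stair : ∀ M → ones (suc M) * 2 ^ M ≡ sumRS (ones (suc (suc M + M)))
sumRS-stair M = *-cancelˡ-≡ _ _ 2 (+-cancelʳ-≡ (2 ^ suc M) _ _ (stair-value (suc M) M (suc M) (length≡ M)))
  where
  length≡ : ∀ M → suc (suc M + M) ≡ 2 * suc M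
  length≡ = solve-∀

sumRS-stair-pumped : ∀ M p →
                     ones (2 * suc p + suc M) * 2 ^ M ≢ sumRS (ones (suc (2 * suc p + suc M + M)))
sumRS-stair-pumped M p m≡sum = <-irrefl 2^[1+M]≡2^[1+M+1+p] (^-monoʳ-< 2 (s≤s (s≤s z≤n)) (m<m+n (suc M) (s≤s z≤n)))
  where
  J = 2 * suc p + suc M
  length≡ : ∀ M p → suc (2 * suc p + suc M + M) ≡ 2 * (suc M + suc p)
  length≡ = solve-∀
  2^[1+M]≡2^[1+M+1+p] : 2 ^ suc M ≡ 2 ^ (suc M + suc p)
  2^[1+M]≡2^[1+M+1+p] = +-cancelˡ-≡ (2 * sumRS (ones (suc (J + M)))) _ _
    (trans (cong (λ x → 2 * x + 2 ^ suc M) (sym m≡sum)) (stair-value J M (suc M + suc p) (length≡ M p)))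

-- Pumping

module _ {A : Set} (f : A → A) where

  iterate-+ : ∀ x m n → iterate f x (m + n) ≡ iterate f (iterate f x m) n
  iterate-+ x zero    n = refl
  iterate-+ x (suc m) n = iterate-+ (f x) m n

  module _ {x a p} (cycle : iterate f x (a + p) ≡ iterate f x a) where

    cycle-shift : ∀ {m} → a ≤ m → iterate f x (p + m) ≡ iterate f x m
    cycle-shift a≤m with m≤n⇒∃[o]m+o≡n a≤m
    ... | e , refl = begin
      iterate f x (p + (a + e))            ≡⟨ cong (iterate f x) (regroup p a e) ⟩
      iterate f x (a + p + e)              ≡⟨ iterate-+ x (a + p) e ⟩
      iterate f (iterate f x (a + p)) e    ≡⟨ cong (λ y → iterate f y e) cycle ⟩
      iterate f (iterate f x a) e          ≡⟨ sym (iterate-+ x a e) ⟩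
      iterate f x (a + e)                  ∎
      where
      open ≡-Reasoning
      regroup : ∀ p a e → p + (a + e) ≡ a + p + e
      regroup = solve-∀

    cycle-repeat : ∀ t {m} → a ≤ m → iterate f x (t * p + m) ≡ iterate f x m
    cycle-repeat zero    a≤m = refl
    cycle-repeat (suc t) {m} a≤m = begin
      iterate f x (p + t * p + m)    ≡⟨ cong (iterate f x) (+-assoc p (t * p) m) ⟩
      iterate f x (p + (t * p + m))  ≡⟨ cycle-shift (≤-trans a≤m (m≤n+m m (t * p))) ⟩
      iterate f x (t * p + m)        ≡⟨ cycle-repeat t a≤m ⟩
      iterate f x m                  ∎
      where open ≡-Reasoning

orbit-cycle : ∀ {n} (f : Fin n → Fin n) x → ∃₂ λ a d → iterate f x (a + suc d) ≡ iterate f x a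
orbit-cycle {n} f x with pigeonhole (n<1+n n) (λ i → iterate f x (toℕ i))
... | i , j , i<j , orbit-i≡orbit-j with m≤n⇒∃[o]m+o≡n i<j
... | d , 1+i+d≡j = toℕ i , d , (begin
  iterate f x (toℕ i + suc d)    ≡⟨ cong (iterate f x) (trans (+-suc (toℕ i) d) 1+i+d≡j) ⟩
  iterate f x (toℕ j)            ≡⟨ sym orbit-i≡orbit-j ⟩
  iterate f x (toℕ i)            ∎)
  where open ≡-Reasoning

foldl-replicate : ∀ {A B : Set} (f : A → B → A) (y : B) q n →
                  foldl f q (replicate n y) ≡ iterate (λ q → f q y) q n
foldl-replicate f y q zero    = refl
foldl-replicate f y q (suc n) = foldl-replicate f y (f q y) n

module _ (A : DFA) where
  open DFA A

  climb : Fin nStates → Fin nStates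
  climb q = step q (true , true)

  q₀ : Fin nStates
  q₀ = step start (true , false)

  stair-state : ∀ J M → accepts A (stairWord J M) ≡ final (foldl step (iterate climb q₀ J) (replicate M (true , false)))
  stair-state J M = cong final (begin
    foldl step q₀ (replicate J (true , true) ++ rest)       ≡⟨ foldl-++ step q₀ (replicate J (true , true)) rest ⟩
    foldl step (foldl step q₀ (replicate J (true , true))) rest
      ≡⟨ cong (λ q → foldl step q rest) (foldl-replicate step (true , true) q₀ J) ⟩
    foldl step (iterate climb q₀ J) rest ∎)
    where
    open ≡-Reasoning
    rest = replicate M (true , false)

  stair-pumping : ∃₂ λ a p → ∀ M →
                  accepts A (stairWord (2 * suc p + suc a) M) ≡ accepts A (stairWord (suc a) M)
  stair-pumping with orbit-cycle climb q₀
  ... | a , d , cycle = a , d , λ M → begin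
    accepts A (stairWord (2 * suc d + suc a) M)
      ≡⟨ stair-state (2 * suc d + suc a) M ⟩
    final (foldl step (iterate climb q₀ (2 * suc d + suc a)) (replicate M (true , false)))
      ≡⟨ cong (λ q → final (foldl step q (replicate M (true , false)))) (cycle-repeat climb cycle 2 (n≤1+n a)) ⟩
    final (foldl step (iterate climb q₀ (suc a)) (replicate M (true , false)))
      ≡⟨ sym (stair-state (suc a) M) ⟩
    accepts A (stairWord (suc a) M) ∎
    where open ≡-Reasoning

mainTheorem3 : ¬ Synchronised₂ sumRS
mainTheorem3 (A , graph) with stair-pumping A
... | a , p , pumped = sumRS-stair-pumped a p (to (graph n₁ m₁) (subst T same accepted₀))
  where
  open Equivalence
  open ≡-Reasoning
  J₁ = 2 * suc p + suc a
  n₀ = ones (suc (suc a + a))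
  m₀ = ones (suc a) * 2 ^ a
  n₁ = ones (suc (J₁ + a))
  m₁ = ones J₁ * 2 ^ a
  accepted₀ : T (accepts A (pairWord n₀ m₀))
  accepted₀ = from (graph n₀ m₀) (sumRS-stair a)
  same : accepts A (pairWord n₀ m₀) ≡ accepts A (pairWord n₁ m₁)
  same = begin
    accepts A (pairWord n₀ m₀)         ≡⟨ cong (accepts A) (pairWord-stair (suc a) a) ⟩
    accepts A (stairWord (suc a) a)    ≡⟨ sym (pumped a) ⟩
    accepts A (stairWord J₁ a)         ≡⟨ cong (accepts A) (sym (pairWord-stair J₁ a)) ⟩
    accepts A (pairWord n₁ m₁)         ∎
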